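{- Let $m\ge n$ and let $C$ be a Hamilton cycle of the grid graph $G(m,n)$. Then $C$ has at least $2n$ turns.
   Context: $G(m,n)$ is the graph on cells $\{1,\dots,m\}\times\{1,\dots,n\}$ with $(a,b),(c,d)$ adjacent iff $|a-c|+|b-d|=1$. A Hamilton cycle is a cycle through every cell. A turn of a cycle is a cell of the cycle whose two incident cycle edges are one horizontal (same second coordinate) and one vertical (same first coordinate). -}

module Defs where

open import Data.Nat using (ℕ; suc; _+_; _*_; _∸_; _≥_; NonZero; ∣_-_∣)
open import Data.Nat.DivMod using (_mod_)
open import Data.Fin using (Fin; toℕ)
open import Data.Product using (_×_; _,_; proj₁; proj₂; Σ)
open import Relation.Binary.PropositionalEquality using (_≡_; _≢_)
open import Relation.Nullary using (¬_)
open import Function.Definitions using (Injective; Surjective)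

-- Cells of G(m,n): (a,b) with a ∈ {1..m}, b ∈ {1..n}, represented 0-based as Fin m × Fin n.
Cell : ℕ → ℕ → Set
Cell m n = Fin m × Fin n

Adjacent : ∀ {m n} → Cell m n → Cell m n → Set
Adjacent (a , b) (c , d) = ∣ toℕ a - toℕ c ∣ + ∣ toℕ b - toℕ d ∣ ≡ 1

Horizontal : ∀ {m n} → Cell m n → Cell m n → Set
Horizontal (a , b) (c , d) = b ≡ d

Vertical : ∀ {m n} → Cell m n → Cell m n → Set
Vertical (a , b) (c , d) = a ≡ c

next : ∀ {N} .{{_ : NonZero N}} → Fin N → Fin N
next {N} i = (suc (toℕ i)) mod N

prev : ∀ {N} .{{_ : NonZero N}} → Fin N → Fin N
prev {N} i = (toℕ i + (N ∸ 1)) mod N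

-- A cycle has at least 3 vertices.
record HamiltonCycle (m n : ℕ) .{{_ : NonZero (m * n)}} : Set where
  field
    c          : Fin (m * n) → Cell m n
    atLeast3   : m * n ≥ 3
    injective  : Injective _≡_ _≡_ c
    surjective : Surjective _≡_ _≡_ c
    adjacent   : ∀ i → Adjacent (c i) (c (next i))

IsTurn : ∀ {m n} .{{_ : NonZero (m * n)}} → HamiltonCycle m n → Fin (m * n) → Set
IsTurn C i =
    (Horizontal (c (prev i)) (c i) × Vertical (c i) (c (next i)))
  ⊎ (Vertical (c (prev i)) (c i) × Horizontal (c i) (c (next i)))
  where open HamiltonCycle C
        open import Data.Sum using (_⊎_)

AtLeastTurns : ∀ {m n} .{{_ : NonZero (m * n)}} → ℕ → HamiltonCycle m n → Set
AtLeastTurns k C = Σ (Fin k → Fin _) λ f → Injective _≡_ _≡_ f × (∀ j → IsTurn C (f j))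

-- Walk along C from an edge lying inside a line (a row or a column), in both directions.
-- Each walk moves monotonically along the line, since the two cycle-neighbours of a cell
-- are different cells, so it must leave the line, and it does so at a turn; the two turns
-- found lie on opposite sides of the edge, hence are distinct.  If each of the n rows
-- contains an edge of C this gives 2n turns.  Otherwise C crosses some row vertically at
-- every cell, so each of the m ≥ n columns contains an edge, giving 2m ≥ 2n turns.

module Submission where

open import Defs
open import Data.Nat using (ℕ; zero; suc; _+_; _*_; _∸_; _≤_; _<_; _≥_; s≤s; s≤s⁻¹; NonZero; ∣_-_∣; _≟_)
open import Data.Nat.DivMod using (_%_; _/_; %-distribˡ-+; m%n%n≡m%n; [m+n]%n≡m%n; m<n⇒m%n≡m; m≡m%n+[m/n]*n)
open import Data.Nat.Divisibility using (divides; ∣⇒≤)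
open import Data.Nat.Properties
open import Data.Fin using (Fin; toℕ; inject≤; remQuot; combine)
open import Data.Fin.Patterns using (0F; 1F)
open import Data.Fin.Properties using (toℕ-injective; toℕ<n; toℕ-fromℕ<; toℕ-inject≤; any?; all?; ¬∀⟶∃¬; combine-remQuot)
open import Data.Product using (_×_; _,_; proj₁; proj₂; Σ; uncurry; swap; map₂)
open import Data.Sum using (_⊎_; inj₁; inj₂)
open import Data.Bool using (Bool; true; false; not)
open import Relation.Binary.PropositionalEquality
open import Relation.Nullary using (¬_; Dec; yes; no; contradiction)
open import Relation.Nullary.Decidable using (_×-dec_)
open import Function.Base using (_∘_)
open import Function.Definitions using (Injective)

suc[n∸1]≡n : ∀ n .{{_ : NonZero n}} → suc (n ∸ 1) ≡ n
suc[n∸1]≡n (suc n) = refl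

module _ {N : ℕ} .{{_ : NonZero N}} where
  open ≡-Reasoning

  [m%N+n]%N≡[m+n]%N : ∀ a b → (a % N + b) % N ≡ (a + b) % N
  [m%N+n]%N≡[m+n]%N a b = begin
    (a % N + b) % N           ≡⟨ %-distribˡ-+ (a % N) b N ⟩
    (a % N % N + b % N) % N   ≡⟨ cong (λ z → (z + b % N) % N) (m%n%n≡m%n a N) ⟩
    (a % N + b % N) % N       ≡⟨ %-distribˡ-+ a b N ⟨
    (a + b) % N               ∎

  [1+m%N]%N≡[1+m]%N : ∀ a → suc (a % N) % N ≡ suc a % N
  [1+m%N]%N≡[1+m]%N a = begin
    suc (a % N) % N   ≡⟨ cong (_% N) (+-comm 1 (a % N)) ⟩
    (a % N + 1) % N   ≡⟨ [m%N+n]%N≡[m+n]%N a 1 ⟩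
    (a + 1) % N       ≡⟨ cong (_% N) (+-comm a 1) ⟩
    suc a % N         ∎

  [1+i+[N∸1]]%N≡i : ∀ (i : Fin N) → (suc (toℕ i) + (N ∸ 1)) % N ≡ toℕ i
  [1+i+[N∸1]]%N≡i i = begin
    (suc (toℕ i) + (N ∸ 1)) % N   ≡⟨ cong (_% N) (+-suc (toℕ i) (N ∸ 1)) ⟨
    (toℕ i + suc (N ∸ 1)) % N     ≡⟨ cong (λ z → (toℕ i + z) % N) (suc[n∸1]≡n N) ⟩
    (toℕ i + N) % N               ≡⟨ [m+n]%n≡m%n (toℕ i) N ⟩
    toℕ i % N                     ≡⟨ m<n⇒m%n≡m (toℕ<n i) ⟩
    toℕ i                         ∎

  next-prev : ∀ (i : Fin N) → next (prev i) ≡ i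
  next-prev i = toℕ-injective (begin
    toℕ (next (prev i))                  ≡⟨ toℕ-fromℕ< _ ⟩
    suc (toℕ (prev i)) % N               ≡⟨ cong (λ z → suc z % N) (toℕ-fromℕ< _) ⟩
    suc ((toℕ i + (N ∸ 1)) % N) % N      ≡⟨ [1+m%N]%N≡[1+m]%N (toℕ i + (N ∸ 1)) ⟩
    suc (toℕ i + (N ∸ 1)) % N            ≡⟨ [1+i+[N∸1]]%N≡i i ⟩
    toℕ i                                ∎)

  prev-next : ∀ (i : Fin N) → prev (next i) ≡ i
  prev-next i = toℕ-injective (begin
    toℕ (prev (next i))                  ≡⟨ toℕ-fromℕ< _ ⟩
    (toℕ (next i) + (N ∸ 1)) % N         ≡⟨ cong (λ z → (z + (N ∸ 1)) % N) (toℕ-fromℕ< _) ⟩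
    (suc (toℕ i) % N + (N ∸ 1)) % N      ≡⟨ [m%N+n]%N≡[m+n]%N (suc (toℕ i)) (N ∸ 1) ⟩
    (suc (toℕ i) + (N ∸ 1)) % N          ≡⟨ [1+i+[N∸1]]%N≡i i ⟩
    toℕ i                                ∎)

  next²≢id : N ≥ 3 → ∀ (i : Fin N) → next (next i) ≢ i
  next²≢id N≥3 i next²i≡i = <⇒≱ N≥3 (∣⇒≤ (divides q 2≡q*N))
    where
      x = toℕ i
      q = (2 + x) / N
      [2+x]%N≡x : (2 + x) % N ≡ x
      [2+x]%N≡x = begin
        suc (suc x) % N          ≡⟨ [1+m%N]%N≡[1+m]%N (suc x) ⟨
        suc (suc x % N) % N      ≡⟨ cong (λ z → suc z % N) (toℕ-fromℕ< _) ⟨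
        suc (toℕ (next i)) % N   ≡⟨ toℕ-fromℕ< _ ⟨
        toℕ (next (next i))      ≡⟨ cong toℕ next²i≡i ⟩
        x                        ∎
      2≡q*N : 2 ≡ q * N
      2≡q*N = +-cancelʳ-≡ x 2 (q * N) (begin
        2 + x              ≡⟨ m≡m%n+[m/n]*n (2 + x) N ⟩
        (2 + x) % N + q * N ≡⟨ cong (_+ q * N) [2+x]%N≡x ⟩
        x + q * N          ≡⟨ +-comm x (q * N) ⟩
        q * N + x          ∎)

  prev≢next : N ≥ 3 → ∀ (i : Fin N) → prev i ≢ next i
  prev≢next N≥3 i prev≡next = next²≢id N≥3 i (trans (cong next (sym prev≡next)) (next-prev i))

∣m-n∣≡1⇒n≡1+m⊎m≡1+n : ∀ a b → ∣ a - b ∣ ≡ 1 → b ≡ suc a ⊎ a ≡ suc b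
∣m-n∣≡1⇒n≡1+m⊎m≡1+n zero          (suc zero)    _ = inj₁ refl
∣m-n∣≡1⇒n≡1+m⊎m≡1+n (suc zero)    zero          _ = inj₂ refl
∣m-n∣≡1⇒n≡1+m⊎m≡1+n (suc a)       (suc b)       e with ∣m-n∣≡1⇒n≡1+m⊎m≡1+n a b e
... | inj₁ b≡1+a = inj₁ (cong suc b≡1+a)
... | inj₂ a≡1+b = inj₂ (cong suc a≡1+b)

UnitStep : ℕ × ℕ → ℕ × ℕ → Set
UnitStep (a , b) (c , d) = (b ≡ d × ∣ a - c ∣ ≡ 1) ⊎ (a ≡ c × ∣ b - d ∣ ≡ 1)

∣Δ₁∣+∣Δ₂∣≡1⇒UnitStep : ∀ a b c d → ∣ a - c ∣ + ∣ b - d ∣ ≡ 1 → UnitStep (a , b) (c , d)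
∣Δ₁∣+∣Δ₂∣≡1⇒UnitStep a b c d e with ∣ a - c ∣ in Δ₁ | ∣ b - d ∣ in Δ₂
... | zero     | _    = inj₂ (∣m-n∣≡0⇒m≡n Δ₁ , e)
... | suc zero | zero = inj₁ (∣m-n∣≡0⇒m≡n Δ₂ , refl)

UnitStep-sym : ∀ {a b c d} → UnitStep (a , b) (c , d) → UnitStep (c , d) (a , b)
UnitStep-sym {a} {b} {c} {d} (inj₁ (b≡d , Δ)) = inj₁ (sym b≡d , trans (∣-∣-comm c a) Δ)
UnitStep-sym {a} {b} {c} {d} (inj₂ (a≡c , Δ)) = inj₂ (sym a≡c , trans (∣-∣-comm d b) Δ)

UnitStep-swap : ∀ {a b c d} → UnitStep (a , b) (c , d) → UnitStep (b , a) (d , c)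
UnitStep-swap (inj₁ s) = inj₂ s
UnitStep-swap (inj₂ s) = inj₁ s

UnitStep-sameLine : ∀ {a b c d} → UnitStep (a , b) (c , d) → b ≡ d → ∣ a - c ∣ ≡ 1
UnitStep-sameLine (inj₁ (_ , Δ)) _ = Δ
UnitStep-sameLine {b = b} (inj₂ (_ , Δ)) refl with () ← trans (sym (∣n-n∣≡0 b)) Δ

UnitStep-otherLine : ∀ {a b c d} → UnitStep (a , b) (c , d) → b ≢ d → a ≡ c
UnitStep-otherLine (inj₁ (b≡d , _)) b≢d = contradiction b≡d b≢d
UnitStep-otherLine (inj₂ (a≡c , _)) _   = a≡c

measure-descent : ∀ {A : Set} {P Q : A → Set} (μ : A → ℕ) →
                  (∀ a → P a → Q a ⊎ Σ A λ b → P b × μ b < μ a) →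
                  ∀ a → P a → Σ A Q
measure-descent {A} {P} {Q} μ step a Pa = go (suc (μ a)) a ≤-refl Pa
  where
    go : ∀ t a → μ a < t → P a → Σ A Q
    go (suc t) a μa<1+t Pa with step a Pa
    ... | inj₁ Qa = a , Qa
    ... | inj₂ (b , Pb , μb<μa) = go t b (<-≤-trans μb<μa (s≤s⁻¹ μa<1+t)) Pb

record DistinctPair {N : ℕ} (P : Fin N → Set) : Set where
  constructor distinct-pair
  field
    first second   : Fin N
    first≢second   : first ≢ second
    P-first        : P first
    P-second       : P second

DistinctPair-map : ∀ {N} {P Q : Fin N → Set} → (∀ {i} → P i → Q i) → DistinctPair P → DistinctPair Q
DistinctPair-map f (distinct-pair i j i≢j Pi Pj) = distinct-pair i j i≢j (f Pi) (f Pj)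

-- x is the coordinate along a line and y indexes the lines; rows and columns are the two instances.
module Lines {N : ℕ} .{{_ : NonZero N}} (pos : Fin N → ℕ × ℕ) (U : ℕ) (x<U : ∀ i → proj₁ (pos i) < U)
  (step : ∀ i → UnitStep (pos i) (pos (next i)))
  (prev≠next : ∀ i → pos (prev i) ≢ pos (next i)) where

  x y : Fin N → ℕ
  x = proj₁ ∘ pos
  y = proj₂ ∘ pos

  Turn : Fin N → Set
  Turn i = (y (prev i) ≡ y i × x i ≡ x (next i)) ⊎ (x (prev i) ≡ x i × y i ≡ y (next i))

  HasEdge : ℕ → Set
  HasEdge w = Σ (Fin N) λ i → y i ≡ w × y (next i) ≡ w

  hasEdge? : ∀ w → Dec (HasEdge w)
  hasEdge? w = any? λ i → (y i ≟ w) ×-dec (y (next i) ≟ w)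

  edgeless⇒crossing : ∀ {w i} → ¬ HasEdge w → y i ≡ w → x i ≡ x (next i)
  edgeless⇒crossing {i = i} noEdge yi≡w =
    UnitStep-otherLine (step i) λ yi≡y[next] → noEdge (i , yi≡w , trans (sym yi≡y[next]) yi≡w)

  neighbour : Bool → Fin N → Fin N
  neighbour false = prev
  neighbour true  = next

  neighbour-not : ∀ k i → neighbour (not k) (neighbour k i) ≡ i
  neighbour-not false = next-prev
  neighbour-not true  = prev-next

  neighbour-step : ∀ k i → UnitStep (pos i) (pos (neighbour k i))
  neighbour-step true  i = step i
  neighbour-step false i =
    UnitStep-sym (subst (UnitStep (pos (prev i)) ∘ pos) (next-prev i) (step (prev i)))

  neighbour-differ : ∀ k i → pos (neighbour k i) ≢ pos (neighbour (not k) i)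
  neighbour-differ false i = prev≠next i
  neighbour-differ true  i = prev≠next i ∘ sym

  RightStep LeftStep : Fin N → Bool → Set
  RightStep i k = y (neighbour k i) ≡ y i × x (neighbour k i) ≡ suc (x i)
  LeftStep  i k = y (neighbour k i) ≡ y i × x i ≡ suc (x (neighbour k i))

  RightStep⇒LeftStep : ∀ k i → RightStep i k → LeftStep (neighbour k i) (not k)
  RightStep⇒LeftStep k i (y≡ , x≡) rewrite neighbour-not k i = sym y≡ , x≡

  LeftStep⇒RightStep : ∀ k i → LeftStep i k → RightStep (neighbour k i) (not k)
  LeftStep⇒RightStep k i (y≡ , x≡) rewrite neighbour-not k i = sym y≡ , x≡

  inLine-neighbour : ∀ k i → y (neighbour k i) ≡ y i →
                     x (neighbour k i) ≡ suc (x i) ⊎ x i ≡ suc (x (neighbour k i))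
  inLine-neighbour k i y≡ = ∣m-n∣≡1⇒n≡1+m⊎m≡1+n _ _ (UnitStep-sameLine (neighbour-step k i) (sym y≡))

  turn-or-straight : ∀ k i → y (neighbour k i) ≡ y i →
                     Turn i ⊎ (y (neighbour (not k) i) ≡ y i × x (neighbour (not k) i) ≢ x (neighbour k i))
  turn-or-straight k i y≡ with y (neighbour (not k) i) ≟ y i
  ... | yes y′≡ = inj₂ (y′≡ , λ x′≡ → neighbour-differ k i (cong₂ _,_ (sym x′≡) (trans y≡ (sym y′≡))))
  ... | no  y′≢ = inj₁ (turn k y≡ y′≢)
    where
      turn : ∀ k → y (neighbour k i) ≡ y i → y (neighbour (not k) i) ≢ y i → Turn i
      turn false y≡ y′≢ = inj₁ (y≡ , UnitStep-otherLine (step i) (y′≢ ∘ sym))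
      turn true  y≡ y′≢ = inj₂ (sym (UnitStep-otherLine (neighbour-step false i) (y′≢ ∘ sym)) , sym y≡)

  continue-left : ∀ k i → RightStep i k → Turn i ⊎ LeftStep i (not k)
  continue-left k i (y≡ , x≡) with turn-or-straight k i y≡
  ... | inj₁ turn = inj₁ turn
  ... | inj₂ (y′≡ , x′≢) with inLine-neighbour (not k) i y′≡
  ...   | inj₁ x′≡ = contradiction (trans x′≡ (sym x≡)) x′≢
  ...   | inj₂ x′≡ = inj₂ (y′≡ , x′≡)

  continue-right : ∀ k i → LeftStep i k → Turn i ⊎ RightStep i (not k)
  continue-right k i (y≡ , x≡) with turn-or-straight k i y≡
  ... | inj₁ turn = inj₁ turn
  ... | inj₂ (y′≡ , x′≢) with inLine-neighbour (not k) i y′≡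
  ...   | inj₁ x′≡ = inj₂ (y′≡ , x′≡)
  ...   | inj₂ x′≡ = contradiction (suc-injective (trans (sym x′≡) x≡)) x′≢

  leftward-turn : ∀ k i → RightStep i k → Σ (Fin N) λ q → y q ≡ y i × x q ≤ x i × Turn q
  leftward-turn k i r = measure-descent x descend i (refl , ≤-refl , k , r)
    where
      descend : ∀ j → y j ≡ y i × x j ≤ x i × Σ Bool (RightStep j) →
                (y j ≡ y i × x j ≤ x i × Turn j) ⊎
                Σ (Fin N) λ o → (y o ≡ y i × x o ≤ x i × Σ Bool (RightStep o)) × x o < x j
      descend j (yj , xj≤ , k , r) with continue-left k j r
      ... | inj₁ turn = inj₁ (yj , xj≤ , turn)
      ... | inj₂ l@(yo , xj≡1+xo) =
        inj₂ (neighbour (not k) j ,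
              (trans yo yj , ≤-trans (<⇒≤ xo<xj) xj≤ , not (not k) , LeftStep⇒RightStep (not k) j l) ,
              xo<xj)
        where
          xo<xj : x (neighbour (not k) j) < x j
          xo<xj = ≤-reflexive (sym xj≡1+xo)

  rightward-turn : ∀ k i → LeftStep i k → Σ (Fin N) λ q → y q ≡ y i × x i ≤ x q × Turn q
  rightward-turn k i l = measure-descent (λ j → U ∸ x j) ascend i (refl , ≤-refl , k , l)
    where
      ascend : ∀ j → y j ≡ y i × x i ≤ x j × Σ Bool (LeftStep j) →
               (y j ≡ y i × x i ≤ x j × Turn j) ⊎
               Σ (Fin N) λ o → (y o ≡ y i × x i ≤ x o × Σ Bool (LeftStep o)) × U ∸ x o < U ∸ x j
      ascend j (yj , ≤xj , k , l) with continue-right k j l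
      ... | inj₁ turn = inj₁ (yj , ≤xj , turn)
      ... | inj₂ r@(yo , xo≡1+xj) =
        inj₂ (neighbour (not k) j ,
              (trans yo yj , ≤-trans ≤xj (<⇒≤ xj<xo) , not (not k) , RightStep⇒LeftStep (not k) j r) ,
              ∸-monoʳ-< xj<xo (<⇒≤ (x<U _)))
        where
          xj<xo : x j < x (neighbour (not k) j)
          xj<xo = ≤-reflexive (sym xo≡1+xj)

  TwoTurnsOn : ℕ → Set
  TwoTurnsOn w = DistinctPair λ q → y q ≡ w × Turn q

  RightStep⇒TwoTurns : ∀ k i → RightStep i k → TwoTurnsOn (y i)
  RightStep⇒TwoTurns k i r@(y≡ , x≡)
    with q₁ , yq₁ , xq₁≤xi , turn₁ ← leftward-turn k i r
       | q₂ , yq₂ , xp≤xq₂ , turn₂ ← rightward-turn (not k) (neighbour k i) (RightStep⇒LeftStep k i r)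
    = distinct-pair q₁ q₂ q₁≢q₂ (yq₁ , turn₁) (trans yq₂ y≡ , turn₂)
    where
      xq₁<xq₂ : x q₁ < x q₂
      xq₁<xq₂ = ≤-trans (s≤s xq₁≤xi) (≤-trans (≤-reflexive (sym x≡)) xp≤xq₂)
      q₁≢q₂ : q₁ ≢ q₂
      q₁≢q₂ q₁≡q₂ = <⇒≢ xq₁<xq₂ (cong x q₁≡q₂)

  edge⇒TwoTurns : ∀ {w} → HasEdge w → TwoTurnsOn w
  edge⇒TwoTurns (i , refl , y[next]≡yi) with inLine-neighbour true i y[next]≡yi
  ... | inj₁ x≡ = RightStep⇒TwoTurns true i (y[next]≡yi , x≡)
  ... | inj₂ x≡ = subst TwoTurnsOn y[next]≡yi
                    (RightStep⇒TwoTurns false (next i) (LeftStep⇒RightStep true i (y[next]≡yi , x≡)))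

pairs⇒injection : ∀ {N n} (ℓ : Fin N → ℕ) (P : Fin N → Set) →
                  (∀ (w : Fin n) → DistinctPair λ i → ℓ i ≡ toℕ w × P i) →
                  Σ (Fin (2 * n) → Fin N) λ f → Injective _≡_ _≡_ f × (∀ j → P (f j))
pairs⇒injection {N} {n} ℓ P pair =
  choose ∘ remQuot {2} n , choose∘remQuot-injective , P-choose ∘ remQuot {2} n
  where
    open DistinctPair

    choose : Fin 2 × Fin n → Fin N
    choose (0F , w) = first (pair w)
    choose (1F , w) = second (pair w)

    ℓ-choose : ∀ bw → ℓ (choose bw) ≡ toℕ (proj₂ bw)
    ℓ-choose (0F , w) = proj₁ (P-first (pair w))
    ℓ-choose (1F , w) = proj₁ (P-second (pair w))

    P-choose : ∀ bw → P (choose bw)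
    P-choose (0F , w) = proj₂ (P-first (pair w))
    P-choose (1F , w) = proj₂ (P-second (pair w))

    choose-injective : Injective _≡_ _≡_ choose
    choose-injective {b , w} {b′ , w′} e
      with refl ← toℕ-injective (trans (sym (ℓ-choose (b , w))) (trans (cong ℓ e) (ℓ-choose (b′ , w′))))
      = cong (_, w) (same-line b b′ e)
      where
        same-line : ∀ b b′ → choose (b , w) ≡ choose (b′ , w) → b ≡ b′
        same-line 0F 0F _ = refl
        same-line 0F 1F e = contradiction e (first≢second (pair w))
        same-line 1F 0F e = contradiction (sym e) (first≢second (pair w))
        same-line 1F 1F _ = refl

    choose∘remQuot-injective : Injective _≡_ _≡_ (choose ∘ remQuot {2} n)
    choose∘remQuot-injective {j} {j′} e = begin
      j                                   ≡⟨ combine-remQuot {2} n j ⟨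
      uncurry combine (remQuot {2} n j)   ≡⟨ cong (uncurry combine) (choose-injective {q} {q′} e) ⟩
      uncurry combine (remQuot {2} n j′)  ≡⟨ combine-remQuot {2} n j′ ⟩
      j′                                  ∎
      where
        open ≡-Reasoning
        q q′ : Fin 2 × Fin n
        q  = remQuot {2} n j
        q′ = remQuot {2} n j′

module _ {m n : ℕ} .{{_ : NonZero (m * n)}} (C : HamiltonCycle m n) where
  open HamiltonCycle C

  column row : Fin (m * n) → ℕ
  column i = toℕ (proj₁ (c i))
  row    i = toℕ (proj₂ (c i))

  cell : Fin (m * n) → ℕ × ℕ
  cell i = column i , row i

  step : ∀ i → UnitStep (cell i) (cell (next i))
  step i = ∣Δ₁∣+∣Δ₂∣≡1⇒UnitStep _ _ _ _ (adjacent i)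

  prev≠next-cell : ∀ i → cell (prev i) ≢ cell (next i)
  prev≠next-cell i e = prev≢next atLeast3 i
    (injective (cong₂ _,_ (toℕ-injective (cong proj₁ e)) (toℕ-injective (cong proj₂ e))))

  module Rows    = Lines cell m (λ i → toℕ<n (proj₁ (c i))) step prev≠next-cell
  module Columns = Lines (swap ∘ cell) n (λ i → toℕ<n (proj₂ (c i)))
                     (UnitStep-swap ∘ step) (λ i → prev≠next-cell i ∘ cong swap)

  row-turn : ∀ {i} → Rows.Turn i → IsTurn C i
  row-turn (inj₁ (h , v)) = inj₁ (toℕ-injective h , toℕ-injective v)
  row-turn (inj₂ (v , h)) = inj₂ (toℕ-injective v , toℕ-injective h)

  column-turn : ∀ {i} → Columns.Turn i → IsTurn C i
  column-turn (inj₁ (v , h)) = inj₂ (toℕ-injective v , toℕ-injective h)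
  column-turn (inj₂ (h , v)) = inj₁ (toℕ-injective h , toℕ-injective v)

  edgeless-row⇒column-edge : ∀ {w} (a : Fin m) → ¬ Rows.HasEdge (toℕ w) → Columns.HasEdge (toℕ a)
  edgeless-row⇒column-edge {w} a noEdge =
    i , column-i , trans (sym (Rows.edgeless⇒crossing noEdge row-i)) column-i
    where
      i : Fin (m * n)
      i = proj₁ (surjective (a , w))
      ci≡ : c i ≡ (a , w)
      ci≡ = proj₂ (surjective (a , w)) refl
      column-i : column i ≡ toℕ a
      column-i = cong (toℕ ∘ proj₁) ci≡
      row-i : row i ≡ toℕ w
      row-i = cong (toℕ ∘ proj₂) ci≡

  every-row-has-edge⇒turns : (∀ (w : Fin n) → Rows.HasEdge (toℕ w)) → AtLeastTurns (2 * n) C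
  every-row-has-edge⇒turns edges =
    pairs⇒injection row (IsTurn C) λ w → DistinctPair-map (map₂ row-turn) (Rows.edge⇒TwoTurns (edges w))

  edgeless-row⇒turns : m ≥ n → (w : Fin n) → ¬ Rows.HasEdge (toℕ w) → AtLeastTurns (2 * n) C
  edgeless-row⇒turns m≥n w noEdge = pairs⇒injection column (IsTurn C) λ v →
    subst (λ a → DistinctPair λ q → column q ≡ a × IsTurn C q) (toℕ-inject≤ v m≥n)
      (DistinctPair-map (map₂ column-turn)
        (Columns.edge⇒TwoTurns (edgeless-row⇒column-edge (inject≤ v m≥n) noEdge)))

lemma9 : (m n : ℕ) .{{_ : NonZero (m * n)}} → m ≥ n → (C : HamiltonCycle m n) → AtLeastTurns (2 * n) C
lemma9 m n m≥n C with all? (Rows.hasEdge? C ∘ toℕ)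
... | yes edges  = every-row-has-edge⇒turns C edges
... | no ¬edges  = let w , noEdge = ¬∀⟶∃¬ n _ (Rows.hasEdge? C ∘ toℕ) ¬edges
                   in edgeless-row⇒turns C m≥n w noEdge
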